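{- For $n\ge 0$ and $k\ge 0$, the number $u_{n,k}$ of tilings of the honeycomb strip $H_n$ by monomers, slanted dimers and trimers using exactly $k$ dimers is $$u_{n,k}=\sum_{\substack{i_0,\dots,i_k\ge 0\\ i_0+\cdots+i_k=n-2k}}N_{i_0}N_{i_1}\cdots N_{i_k},$$ where $N_j$ is Narayana's cows sequence: $N_0=N_1=N_2=1$ and $N_j=N_{j-1}+N_{j-3}$ for $j\ge3$.
   Context: The honeycomb strip $H_n$ consists of $n$ regular hexagons numbered $1,\dots,n$ arranged in two rows (odd-numbered on the bottom, even-numbered on top), hexagon $i$ sharing an edge with hexagons $i\pm1$ and $i\pm2$. The allowed tiles are: monomers $\{i\}$, slanted dimers $\{i,i+1\}$, and trimers $\{i,i+1,i+2\}$ (horizontal dimers $\{i,i+2\}$ are not allowed); a tiling is a partition of the hexagons of $H_n$ into such tiles, and $H_0$ has one (empty) tiling. An empty sum (when $n-2k<0$) is $0$. -}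

module Defs where

open import Data.Nat using (ℕ; zero; suc; _+_; _*_; _∸_; _≤?_)
open import Relation.Nullary using (yes; no)

-- Allowed tiles are
-- monomers {i}, slanted dimers {i,i+1}, trimers {i,i+1,i+2}; every allowed
-- tile is a block of consecutive indices, so a tiling is determined by the
-- tile containing the lowest-numbered hexagon followed by a tiling of the rest.
data Tiling : ℕ → Set where
  empty  : Tiling 0
  mono   : ∀ {n} → Tiling n → Tiling (suc n)
  dimer  : ∀ {n} → Tiling n → Tiling (suc (suc n))
  trimer : ∀ {n} → Tiling n → Tiling (suc (suc (suc n)))

dimers : ∀ {n} → Tiling n → ℕ
dimers empty      = 0
dimers (mono t)   = dimers t
dimers (dimer t)  = suc (dimers t)
dimers (trimer t) = dimers t

N : ℕ → ℕ
N 0 = 1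
N 1 = 1
N 2 = 1
N (suc (suc (suc j))) = N (suc (suc j)) + N j

sumTo : ℕ → (ℕ → ℕ) → ℕ
sumTo zero    f = f 0
sumTo (suc m) f = sumTo m f + f (suc m)

-- convolution k m = Σ_{i_0+...+i_k = m, i_j ≥ 0} N i_0 ⋯ N i_k
-- (nested sum: i_0 ranges over 0..m, the remaining k indices sum to m - i_0)
convolution : ℕ → ℕ → ℕ
convolution zero    m = N m
convolution (suc k) m = sumTo m (λ i → N i * convolution k (m ∸ i))

-- right-hand side of the theorem; empty sum (0) when n - 2k < 0
rhs : ℕ → ℕ → ℕ
rhs n k with 2 * k ≤? n
... | yes _ = convolution k (n ∸ 2 * k)
... | no  _ = 0

{-# OPTIONS --safe #-}
module Submission where

-- Removing the first tile (a monomer, dimer or trimer) shows that for fixed k the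
-- sequence u_k(n) = u_{n,k} satisfies u_k(n+1) = u_k(n) + u_{k-1}(n-1) + u_k(n-2).
-- In generating functions, (1 - x - x³) U_k = x² U_{k-1} and U_0 = 1/(1 - x - x³)
-- is the generating function of N, so U_k = x^{2k} (1/(1 - x - x³))^{k+1}, whose
-- coefficients are the (k+1)-fold convolutions of N delayed by 2k.  Generating
-- functions are represented by their coefficient sequences: multiplication by x
-- is `delay`, and division by 1 - x - x³ is convolution with N.

open import Defs
open import Data.Empty using (⊥)
open import Data.Fin using (Fin)
import Data.Fin as Fin
open import Data.Fin.Properties using (+↔⊎; 0↔⊥)
open import Data.Nat using (ℕ; zero; suc; _+_; _*_; _∸_; _<_; _≤?_; s≤s)
open import Data.Nat.GeneralisedArithmetic using (fold)
open import Data.Nat.Properties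
  using (+-assoc; +-identityʳ; *-identityˡ; *-distribʳ-+; *-suc; m+[n∸m]≡n; ≰⇒>;
         +-commutativeSemigroup)
open import Algebra.Properties.CommutativeSemigroup +-commutativeSemigroup
  using (interchange; x∙yz≈yx∙z)
open import Data.Product using (Σ; _,_)
open import Data.Sum using (_⊎_; inj₁; inj₂)
open import Data.Sum.Function.Propositional using (_⊎-↔_)
open import Function.Bundles using (_↔_; mk↔ₛ′)
open import Function.Properties.Inverse using (↔-refl; ↔-sym; ↔-trans)
open import Relation.Nullary using (yes; no)
open import Relation.Binary.PropositionalEquality
  using (_≡_; refl; sym; trans; cong; cong₂; module ≡-Reasoning)

sumTo-cong : ∀ m {f g : ℕ → ℕ} → (∀ i → f i ≡ g i) → sumTo m f ≡ sumTo m g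
sumTo-cong zero    f≗g = f≗g 0
sumTo-cong (suc m) f≗g = cong₂ _+_ (sumTo-cong m f≗g) (f≗g (suc m))

sumTo-+ : ∀ m (f g : ℕ → ℕ) → sumTo m (λ i → f i + g i) ≡ sumTo m f + sumTo m g
sumTo-+ zero    f g = refl
sumTo-+ (suc m) f g = begin
  sumTo m (λ i → f i + g i) + (f (suc m) + g (suc m))
    ≡⟨ cong (_+ (f (suc m) + g (suc m))) (sumTo-+ m f g) ⟩
  (sumTo m f + sumTo m g) + (f (suc m) + g (suc m))
    ≡⟨ interchange (sumTo m f) (sumTo m g) (f (suc m)) (g (suc m)) ⟩
  (sumTo m f + f (suc m)) + (sumTo m g + g (suc m)) ∎
  where open ≡-Reasoning

sumTo-suc : ∀ m (f : ℕ → ℕ) → sumTo (suc m) f ≡ f 0 + sumTo m (λ i → f (suc i))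
sumTo-suc zero    f = refl
sumTo-suc (suc m) f = trans (cong (_+ f (suc (suc m))) (sumTo-suc m f))
                            (+-assoc (f 0) _ _)

delay : (ℕ → ℕ) → ℕ → ℕ
delay a zero    = 0
delay a (suc n) = a n

delay² : (ℕ → ℕ) → ℕ → ℕ
delay² a = delay (delay a)

infixl 7 _⋆_
_⋆_ : (ℕ → ℕ) → (ℕ → ℕ) → ℕ → ℕ
(a ⋆ b) m = sumTo m (λ i → a i * b (m ∸ i))

⋆-distribʳ-+ : ∀ (a a′ b : ℕ → ℕ) m →
               ((λ i → a i + a′ i) ⋆ b) m ≡ (a ⋆ b) m + (a′ ⋆ b) m
⋆-distribʳ-+ a a′ b m =
  trans (sumTo-cong m (λ i → *-distribʳ-+ (b (m ∸ i)) (a i) (a′ i))) (sumTo-+ m _ _)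

delay-⋆ : ∀ (a b : ℕ → ℕ) m → (delay a ⋆ b) m ≡ delay (a ⋆ b) m
delay-⋆ a b zero    = refl
delay-⋆ a b (suc m) = sumTo-suc m _

delay²-⋆ : ∀ (a b : ℕ → ℕ) m → (delay² a ⋆ b) m ≡ delay² (a ⋆ b) m
delay²-⋆ a b zero    = refl
delay²-⋆ a b (suc m) = trans (delay-⋆ (delay a) b (suc m)) (delay-⋆ a b m)

N-suc : ∀ n → N (suc n) ≡ N n + delay² N n
N-suc zero          = refl
N-suc (suc zero)    = refl
N-suc (suc (suc n)) = refl

-- c is the coefficient sequence of B(x) / (1 - x - x³), where B is that of b.
record NarayanaSolution (b c : ℕ → ℕ) : Set where
  field
    initial : c 0 ≡ b 0
    step    : ∀ n → c (suc n) ≡ c n + b (suc n) + delay² c n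

open NarayanaSolution

δ : ℕ → ℕ
δ zero    = 1
δ (suc n) = 0

N-solution : NarayanaSolution δ N
N-solution .initial = refl
N-solution .step n  = trans (N-suc n) (cong (_+ delay² N n) (sym (+-identityʳ (N n))))

N⋆-solution : ∀ b → NarayanaSolution b (N ⋆ b)
N⋆-solution b .initial = *-identityˡ (b 0)
N⋆-solution b .step m  = begin
  (N ⋆ b) (suc m)
    ≡⟨ sumTo-suc m _ ⟩
  1 * b (suc m) + ((λ i → N (suc i)) ⋆ b) m
    ≡⟨ cong₂ _+_ (*-identityˡ (b (suc m)))
                 (sumTo-cong m (λ i → cong (_* b (m ∸ i)) (N-suc i))) ⟩
  b (suc m) + ((λ i → N i + delay² N i) ⋆ b) m
    ≡⟨ cong (b (suc m) +_) (⋆-distribʳ-+ N (delay² N) b m) ⟩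
  b (suc m) + ((N ⋆ b) m + (delay² N ⋆ b) m)
    ≡⟨ cong (λ x → b (suc m) + ((N ⋆ b) m + x)) (delay²-⋆ N b m) ⟩
  b (suc m) + ((N ⋆ b) m + delay² (N ⋆ b) m)
    ≡⟨ x∙yz≈yx∙z (b (suc m)) ((N ⋆ b) m) (delay² (N ⋆ b) m) ⟩
  (N ⋆ b) m + b (suc m) + delay² (N ⋆ b) m ∎
  where open ≡-Reasoning

delay-solution : ∀ {b c} → NarayanaSolution b c → NarayanaSolution (delay b) (delay c)
delay-solution s .initial      = refl
delay-solution s .step zero    = trans (s .initial) (sym (+-identityʳ _))
delay-solution s .step (suc n) = s .step n

fold-delay²-solution : ∀ {b c} k → NarayanaSolution b c →
                   NarayanaSolution (fold b delay² k) (fold c delay² k)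
fold-delay²-solution zero    s = s
fold-delay²-solution (suc k) s = delay-solution (delay-solution (fold-delay²-solution k s))

tilingCount : ℕ → ℕ → ℕ
tilingCount k = fold (convolution k) delay² k

dimerSource : ℕ → ℕ → ℕ
dimerSource zero    = δ
dimerSource (suc k) = delay² (tilingCount k)

tilingCount-solution : ∀ k → NarayanaSolution (dimerSource k) (tilingCount k)
tilingCount-solution zero    = N-solution
tilingCount-solution (suc k) = fold-delay²-solution (suc k) (N⋆-solution (convolution k))

fold-delay²-+ : ∀ k (a : ℕ → ℕ) m → fold a delay² k (2 * k + m) ≡ a m
fold-delay²-+ zero    a m = refl
fold-delay²-+ (suc k) a m =
  trans (cong (λ n → fold a delay² (suc k) (n + m)) (*-suc 2 k)) (fold-delay²-+ k a m)

fold-delay²-< : ∀ k (a : ℕ → ℕ) n → n < 2 * k → fold a delay² k n ≡ 0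
fold-delay²-< (suc k) a zero          _ = refl
fold-delay²-< (suc k) a (suc zero)    _ = refl
fold-delay²-< (suc k) a (suc (suc n)) 2+n<2k+2 rewrite *-suc 2 k with 2+n<2k+2
... | s≤s (s≤s n<2k) = fold-delay²-< k a n n<2k

rhs≡tilingCount : ∀ n k → rhs n k ≡ tilingCount k n
rhs≡tilingCount n k with 2 * k ≤? n
... | yes 2k≤n = sym (trans (cong (tilingCount k) (sym (m+[n∸m]≡n 2k≤n)))
                            (fold-delay²-+ k (convolution k) (n ∸ 2 * k)))
... | no  2k≰n = sym (fold-delay²-< k (convolution k) n (≰⇒> 2k≰n))

Tilings : ℕ → ℕ → Set
Tilings k n = Σ (Tiling n) (λ t → dimers t ≡ k)

Delayed : (ℕ → Set) → ℕ → Set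
Delayed A zero    = ⊥
Delayed A (suc n) = A n

-- What remains of a tiling of H_{n+1} with k dimers after removing its leading dimer.
AfterDimer : ℕ → ℕ → Set
AfterDimer zero    n = ⊥
AfterDimer (suc k) n = Delayed (Tilings k) n

leadingTile↔ : ∀ k n →
  Tilings k (suc n) ↔ ((Tilings k n ⊎ AfterDimer k n) ⊎ Delayed (Delayed (Tilings k)) n)
leadingTile↔ k n = mk↔ₛ′ (split n) (join n) (split∘join n) (join∘split n)
  where
  split : ∀ {k} n → Tilings k (suc n) →
          (Tilings k n ⊎ AfterDimer k n) ⊎ Delayed (Delayed (Tilings k)) n
  split n             (mono t   , p)    = inj₁ (inj₁ (t , p))
  split (suc n)       (dimer t  , refl) = inj₁ (inj₂ (t , refl))
  split (suc (suc n)) (trimer t , p)    = inj₂ (t , p)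

  join : ∀ {k} n → (Tilings k n ⊎ AfterDimer k n) ⊎ Delayed (Delayed (Tilings k)) n →
         Tilings k (suc n)
  join         n             (inj₁ (inj₁ (t , p))) = mono t , p
  join {suc k} (suc n)       (inj₁ (inj₂ (t , p))) = dimer t , cong suc p
  join {zero}  _             (inj₁ (inj₂ ()))
  join {suc k} zero          (inj₁ (inj₂ ()))
  join         (suc (suc n)) (inj₂ (t , p))        = trimer t , p

  split∘join : ∀ {k} n x → split {k} n (join n x) ≡ x
  split∘join         n             (inj₁ (inj₁ _))          = refl
  split∘join {suc k} (suc n)       (inj₁ (inj₂ (_ , refl))) = refl
  split∘join         (suc (suc n)) (inj₂ _)                 = refl

  join∘split : ∀ {k} n x → join {k} n (split n x) ≡ x
  join∘split n             (mono _   , _)    = refl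
  join∘split (suc n)       (dimer _  , refl) = refl
  join∘split (suc (suc n)) (trimer _ , _)    = refl

Fin-+-+ : ∀ {a b c} → Fin (a + b + c) ↔ ((Fin a ⊎ Fin b) ⊎ Fin c)
Fin-+-+ = ↔-trans +↔⊎ (+↔⊎ ⊎-↔ ↔-refl)

Fin-cong : ∀ {a b} → a ≡ b → Fin a ↔ Fin b
Fin-cong refl = ↔-refl

⊥↔Fin0 : ⊥ ↔ Fin 0
⊥↔Fin0 = ↔-sym 0↔⊥

mutual
  tilings↔ : ∀ k n → Tilings k n ↔ Fin (tilingCount k n)
  tilings↔ zero    zero = mk↔ₛ′ (λ _ → Fin.zero) (λ _ → empty , refl)
    (λ { Fin.zero → refl ; (Fin.suc ()) }) (λ { (empty , refl) → refl })
  tilings↔ (suc k) zero = mk↔ₛ′ (λ { (empty , ()) }) (λ ()) (λ ()) (λ { (empty , ()) })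
  tilings↔ k (suc n) =
    ↔-trans (leadingTile↔ k n)
    (↔-trans ((tilings↔ k n ⊎-↔ afterDimer↔ k n) ⊎-↔ afterTrimer↔ k n)
    (↔-trans (↔-sym Fin-+-+)
             (Fin-cong (sym (tilingCount-solution k .step n)))))

  afterDimer↔ : ∀ k n → AfterDimer k n ↔ Fin (dimerSource k (suc n))
  afterDimer↔ zero    n       = ⊥↔Fin0
  afterDimer↔ (suc k) zero    = ⊥↔Fin0
  afterDimer↔ (suc k) (suc n) = tilings↔ k n

  afterTrimer↔ : ∀ k n → Delayed (Delayed (Tilings k)) n ↔ Fin (delay² (tilingCount k) n)
  afterTrimer↔ k zero          = ⊥↔Fin0
  afterTrimer↔ k (suc zero)    = ⊥↔Fin0
  afterTrimer↔ k (suc (suc n)) = tilings↔ k n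

theorem10 : (n k : ℕ) → Σ (Tiling n) (λ t → dimers t ≡ k) ↔ Fin (rhs n k)
theorem10 n k = ↔-trans (tilings↔ k n) (Fin-cong (sym (rhs≡tilingCount n k)))
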